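{- Let $A=[a_1,b_1]\times[a_2,b_2]$, let $\alpha_1,\dots,\alpha_k$ be $2$-forms with continuous coefficients on $A$ such that none of the iterated integrals $I_A(M,\sigma_1,\sigma_2)$ vanishes, and let $J_A(\alpha_1,\dots,\alpha_k)=\sum r_A(M,\sigma_1,\sigma_2)\in R_A$, the sum running over all equivalence classes of triples (of all degrees, including the degree-$0$ term $1$), convergent in the inverse-limit topology. Then $J_A$ is group-like for the coproduct $\Delta$ of $R_A$: $$\Delta J_A(\alpha_1,\dots,\alpha_k)=J_A(\alpha_1,\dots,\alpha_k)\otimes J_A(\alpha_1,\dots,\alpha_k).$$
   Context: For $2$-forms $\beta_j=g_j\,dx\wedge dy$ on $A$ and permutations $\sigma_1,\sigma_2$ of $\{1,\dots,n\}$, $I_A(\beta_1,\dots,\beta_n,\sigma_1,\sigma_2)$ is the integral of $\prod_j g_j(x_j,y_j)$ over $\{a_1\le x_{\sigma_1(1)}\le\dots\le x_{\sigma_1(n)}\le b_1\}\times\{a_2\le y_{\sigma_2(1)}\le\dots\le y_{\sigma_2(n)}\le b_2\}$. Words $M=(m_1,\dots,m_n)$, $m_j\in\{1,\dots,k\}$, $\deg M=n$; $I_A(M,\sigma_1,\sigma_2)=I_A(\alpha_{m_1},\dots,\alpha_{m_n},\sigma_1,\sigma_2)$. Triples $(M,\sigma_1,\sigma_2)$ and $(M',\sigma_1',\sigma_2')$ are equivalent if for some permutation $\pi$, $m'_j=m_{\pi(j)}$ and $\sigma'_i=\pi^{ -1}\circ\sigma_i$; every class has a unique representative with $\sigma_1=\mathrm{id}$.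 $R^0_A$ is the free $\mathbb Z$-module on symbols $r_A(M,\sigma_1,\sigma_2)$, one per class, with degree-$0$ class $=1$, and multiplication $r_A(M,\sigma_1,\sigma_2)r_A(N,\tau_1,\tau_2)=\sum_{\rho_i\in\Sigma(\sigma_i)(\tau_i^{+m})} r_A(MN,\rho_1,\rho_2)$ ($m=\deg M$, $\tau^{+m}(m+j)=m+\tau(j)$, and $\Sigma(\sigma)(\tau')$ the permutations $\rho$ of $\{1,\dots,m+n\}$ whose value sequence contains $\sigma(1),\dots,\sigma(m)$ in order and $\tau'(m+1),\dots,\tau'(m+n)$ in order); $R_A=\varprojlim R^0_A/I(n)$, $I(n)$ the ideal generated by basis elements of degree $>n$. The coproduct: for a basis element of degree $n$ written with representative $r_A(M,\mathrm{id},\rho_2)$, $\Delta=\sum_{i=0}^n\Delta^i$, where $\Delta^0(r)=1\otimes r$, $\Delta^n(r)=r\otimes 1$, and for $0<i<n$, $\Delta^i(r_A(M,\mathrm{id},\rho_2))=r_A(M',\mathrm{id},\sigma_2)\otimes r_A(M'',\mathrm{id},\tau_2)$ if $M=M'M''$ with $\deg M'=i$ and $\rho_2$ maps $\{1,\dots,i\}$ to itself, $\sigma_2=\rho_2|_{\{1,\dots,i\}}$, $\tau_2(j)=\rho_2(i+j)-i$; otherwise $\Delta^i=0$. $\Delta$ is extended $\mathbb Z$-linearly and continuously to $R_A\to R_A\hat\otimes R_A$. -}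

module Defs where

open import Data.Bool using (Bool; true; false; if_then_else_; _∧_; T)
open import Data.Nat as ℕ using (ℕ; zero; suc; _∸_; _<ᵇ_; _≡ᵇ_)
open import Data.Fin as Fin using (Fin)
open import Data.List using (List; []; _∷_; map; concatMap; filter; take; drop;
  length; upTo; foldr; allFin)
open import Data.List.Properties using (≡-dec)
open import Data.Maybe using (Maybe; just; nothing)
open import Data.Product using (_×_; _,_)
open import Data.Integer as ℤ using (ℤ; +_)
open import Relation.Nullary.Decidable using (does; _×-dec_)
open import Relation.Binary.PropositionalEquality using (_≡_)

-- A class of triples (M, σ₁, σ₂) is represented by its unique
-- representative with σ₁ = id, i.e. by a pair (M , ρ) where
--   M : List (Fin k)   is the word (m₁,…,mₙ)  (letters 0-based: Fin k)
--   ρ : List ℕ         is the value list ρ₂(1),…,ρ₂(n) of the permutation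
--                      σ₂, written 0-based (values in {0,…,n-1}).
-- The degree-0 class (the element 1) is ([] , []).

allᵇ : ∀ {a} {A : Set a} → (A → Bool) → List A → Bool
allᵇ p []       = true
allᵇ p (x ∷ xs) = p x ∧ allᵇ p xs

countᵇ : (ℕ → Bool) → List ℕ → ℕ
countᵇ p []       = 0
countᵇ p (x ∷ xs) = if p x then suc (countᵇ p xs) else countᵇ p xs

isPermᵇ : List ℕ → Bool
isPermᵇ ρ = allᵇ (λ j → countᵇ (λ x → x ≡ᵇ j) ρ ≡ᵇ 1) (upTo (length ρ))

IsBasis : ∀ {k} → List (Fin k) → List ℕ → Set
IsBasis M ρ = (length M ≡ length ρ) × T (isPermᵇ ρ)

allLists : ∀ {a} {A : Set a} → List A → ℕ → List (List A)
allLists xs zero    = [] ∷ []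
allLists xs (suc n) = concatMap (λ x → map (x ∷_) (allLists xs n)) xs

words : (k n : ℕ) → List (List (Fin k))
words k n = allLists (allFin k) n

perms : ℕ → List (List ℕ)
perms n = filter (λ ρ → T? (isPermᵇ ρ)) (allLists (upTo n) n)
  where
  open import Relation.Nullary.Decidable using () renaming (T? to T?)

-- Each degree has finitely many basis elements, so an element of R_A is
-- an arbitrary ℤ-valued coefficient function on the basis (only the
-- values on pairs satisfying IsBasis are meaningful).
RA : ℕ → Set
RA k = List (Fin k) → List ℕ → ℤ

-- Elements of the completed tensor product R_A ⊗̂ R_A: coefficient
-- functions on pairs of basis elements  r' ⊗ r''.
RA⊗RA : ℕ → Set
RA⊗RA k = List (Fin k) → List ℕ → List (Fin k) → List ℕ → ℤ

_⊗_ : ∀ {k} → RA k → RA k → RA⊗RA k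
(f ⊗ g) M' σ M'' τ = f M' σ ℤ.* g M'' τ

-- Δ^i on a basis element r_A(M, id, ρ):  just (M', σ₂, M'', τ₂) when
-- ρ maps {0,…,i-1} to itself (then σ₂ = ρ|, τ₂(j) = ρ(i+j) - i),
-- nothing (i.e. Δ^i = 0) otherwise.  For i = 0 this gives 1 ⊗ r and for
-- i = n it gives r ⊗ 1.
split : ∀ {k} → ℕ → List (Fin k) → List ℕ →
        Maybe (List (Fin k) × List ℕ × List (Fin k) × List ℕ)
split i M ρ =
  if allᵇ (λ x → x <ᵇ i) (take i ρ)
  then just (take i M , take i ρ , drop i M , map (λ x → x ∸ i) (drop i ρ))
  else nothing

-- coefficient of r' ⊗ r'' in Δ(r) = Σ_{i=0}^{n} Δ^i(r),  n = deg r
Δcoeff : ∀ {k} → List (Fin k) → List ℕ →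
         List (Fin k) → List ℕ → List (Fin k) → List ℕ → ℤ
Δcoeff {k} M ρ M' σ M'' τ =
  foldr (λ i acc → hit (split i M ρ) ℤ.+ acc) (+ 0) (upTo (suc (length M)))
  where
  hit : Maybe (List (Fin k) × List ℕ × List (Fin k) × List ℕ) → ℤ
  hit nothing = + 0
  hit (just (A , B , C , D)) =
    if does (≡-dec Fin._≟_ A M' ×-dec ≡-dec ℕ._≟_ B σ
             ×-dec ≡-dec Fin._≟_ C M'' ×-dec ≡-dec ℕ._≟_ D τ)
    then + 1 else + 0

-- Since Δ^i maps degree n to
-- degrees (i, n-i), only r of degree deg r' + deg r'' contribute, so the
-- sum is the finite sum over basis elements of that degree.
Δ : ∀ {k} → RA k → RA⊗RA k
Δ {k} f M' σ M'' τ =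
  foldr ℤ._+_ (+ 0)
    (concatMap (λ M → map (λ ρ → f M ρ ℤ.* Δcoeff M ρ M' σ M'' τ) (perms n))
               (words k n))
  where n = length M' ℕ.+ length M''

J : (k : ℕ) → RA k
J k M ρ = + 1

-- Since Δ^i r has a
-- left factor of degree i, only the cut i = deg r' can contribute, and it pins r down: its word is
-- M'M'' and its permutation is σ followed by τ shifted up by deg r' (the shift is forced because σ
-- already takes all values below deg r').  So each coefficient of Δ f is a single coefficient of f;
-- for J all coefficients are 1, and 1 = 1 · 1.

{-# OPTIONS --safe #-}
module Submission where

open import Defs
open import Data.Nat using (ℕ)
open import Data.Fin using (Fin)
open import Data.List using (List)
open import Relation.Binary.PropositionalEquality using (_≡_)

open import Data.Bool using (Bool; T; true; false; if_then_else_)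
open import Data.Bool.Properties using (T-∧; T-≡)
open import Data.Nat
  using (zero; suc; _+_; _∸_; _≤_; _<_; _<?_; _≟_; _≡ᵇ_; _<ᵇ_; s≤s; s≤s⁻¹; _⊓_)
import Data.Nat.Properties as ℕ
import Data.Fin as Fin
open import Data.Integer using (ℤ; +_) renaming (_+_ to _+ℤ_; _*_ to _*ℤ_)
import Data.Integer.Properties as ℤ
open import Data.List
  using ([]; _∷_; _++_; map; filter; concatMap; foldr; take; drop; length; upTo; applyUpTo;
         allFin; cartesianProductWith; cartesianProduct)
open import Data.List.Properties
  using (≡-dec; ∷-injective; map-++; map-∘; map-id-local; length-++; length-map; length-++-≤ˡ;
         length-take; take++drop≡id; filter-++; filter-accept; filter-reject; filter-none;
         filter-some; filter-notAll)
open import Data.List.Membership.Propositional using (_∈_)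
open import Data.List.Membership.Propositional.Properties
  using (∈-cartesianProductWith⁺; ∈-cartesianProductWith⁻; ∈-cartesianProduct⁺;
         ∈-cartesianProduct⁻; ∈-filter⁺; ∈-filter⁻; ∈-upTo⁺; ∈-upTo⁻; ∈-allFin)
open import Data.List.Relation.Unary.All as All using (All; []; _∷_)
open import Data.List.Relation.Unary.All.Properties using (applyUpTo⁺₁; applyUpTo⁻; map⁺)
open import Data.List.Relation.Unary.All.Properties.Core using (¬All⇒Any¬)
open import Data.List.Relation.Unary.Any as Any using (here; there)
open import Data.List.Relation.Unary.AllPairs using ([]; _∷_)
open import Data.List.Relation.Unary.Unique.Propositional using (Unique)
open import Data.List.Relation.Unary.Unique.Propositional.Properties
  using (upTo⁺; allFin⁺; filter⁺; cartesianProductWith⁺; cartesianProduct⁺)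
open import Data.Maybe using (Maybe; just; nothing)
open import Data.Product using (_×_; _,_; proj₁; proj₂; uncurry)
open import Function using (_∘_; id; _⇔_; mk⇔; Equivalence)
open import Relation.Binary using (tri<; tri≈; tri>)
open import Relation.Nullary using (yes; no; does)
open import Relation.Nullary.Decidable using (_×-dec_; dec-true; dec-false; decidable-stable)
open import Relation.Binary.PropositionalEquality
  using (refl; sym; trans; cong; cong₂; subst; subst₂; _≢_; module ≡-Reasoning)

open ≡-Reasoning
open Equivalence using (to; from)

private variable
  A B C : Set

sumℤ : List ℤ → ℤ
sumℤ = foldr _+ℤ_ (+ 0)

foldr-as-sumℤ : (F : A → ℤ → ℤ) (f : A → ℤ) → (∀ x a → F x a ≡ f x +ℤ a) →
                ∀ xs → foldr F (+ 0) xs ≡ sumℤ (map f xs)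
foldr-as-sumℤ F f step []       = refl
foldr-as-sumℤ F f step (x ∷ xs) =
  trans (step x _) (cong (f x +ℤ_) (foldr-as-sumℤ F f step xs))

sumℤ-map-zero : ∀ (f : A → ℤ) {xs} → (∀ {x} → x ∈ xs → f x ≡ + 0) → sumℤ (map f xs) ≡ + 0
sumℤ-map-zero f {[]}     vanish = refl
sumℤ-map-zero f {x ∷ xs} vanish =
  cong₂ _+ℤ_ (vanish (here refl)) (sumℤ-map-zero f (vanish ∘ there))

sumℤ-map-unique : ∀ (f : A → ℤ) {xs x} → Unique xs → x ∈ xs →
                  (∀ {y} → y ∈ xs → y ≢ x → f y ≡ + 0) → sumℤ (map f xs) ≡ f x
sumℤ-map-unique f {x ∷ xs} (x≢xs ∷ _) (here refl) vanish =
  trans (cong (f x +ℤ_) (sumℤ-map-zero f λ y∈ → vanish (there y∈) (All.lookup x≢xs y∈ ∘ sym)))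
        (ℤ.+-identityʳ (f x))
sumℤ-map-unique f {y ∷ xs} (y≢xs ∷ xs-unique) (there x∈) vanish =
  trans (cong₂ _+ℤ_ (vanish (here refl) (All.lookup y≢xs x∈))
                    (sumℤ-map-unique f xs-unique x∈ (vanish ∘ there)))
        (ℤ.+-identityˡ _)

concatMap-map≡cartesianProductWith : ∀ (f : A → B → C) xs ys →
  concatMap (λ x → map (f x) ys) xs ≡ cartesianProductWith f xs ys
concatMap-map≡cartesianProductWith f []       ys = refl
concatMap-map≡cartesianProductWith f (x ∷ xs) ys =
  cong (map (f x) ys ++_) (concatMap-map≡cartesianProductWith f xs ys)

cartesianProductWith≡map-cartesianProduct : ∀ (f : A → B → C) xs ys →
  cartesianProductWith f xs ys ≡ map (uncurry f) (cartesianProduct xs ys)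
cartesianProductWith≡map-cartesianProduct f []       ys = refl
cartesianProductWith≡map-cartesianProduct f (x ∷ xs) ys = begin
  map (f x) ys ++ cartesianProductWith f xs ys
    ≡⟨ cong₂ _++_ (map-∘ ys) (cartesianProductWith≡map-cartesianProduct f xs ys) ⟩
  map (uncurry f) (map (x ,_) ys) ++ map (uncurry f) (cartesianProduct xs ys)
    ≡⟨ map-++ (uncurry f) (map (x ,_) ys) _ ⟨
  map (uncurry f) (cartesianProduct (x ∷ xs) ys) ∎

take-length-++ : ∀ (xs ys : List A) → take (length xs) (xs ++ ys) ≡ xs
take-length-++ []       ys = refl
take-length-++ (x ∷ xs) ys = cong (x ∷_) (take-length-++ xs ys)

drop-length-++ : ∀ (xs ys : List A) → drop (length xs) (xs ++ ys) ≡ ys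
drop-length-++ []       ys = refl
drop-length-++ (x ∷ xs) ys = drop-length-++ xs ys

map-∸-map-+ : ∀ m τ → map (_∸ m) (map (_+ m) τ) ≡ τ
map-∸-map-+ m τ =
  trans (sym (map-∘ τ)) (map-id-local (All.universal (λ x → ℕ.m+n∸n≡m x m) τ))

map-+-map-∸ : ∀ m {δ} → All (m ≤_) δ → map (_+ m) (map (_∸ m) δ) ≡ δ
map-+-map-∸ m {δ} m≤δ = trans (sym (map-∘ δ)) (map-id-local (All.map ℕ.m∸n+n≡m m≤δ))

allLists-suc : ∀ (xs : List A) n →
  allLists xs (suc n) ≡ cartesianProductWith _∷_ xs (allLists xs n)
allLists-suc xs n = concatMap-map≡cartesianProductWith _∷_ xs (allLists xs n)

allLists-unique : ∀ {xs : List A} → Unique xs → ∀ n → Unique (allLists xs n)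
allLists-unique xs-unique zero    = [] ∷ []
allLists-unique {xs = xs} xs-unique (suc n) =
  subst Unique (sym (allLists-suc xs n))
        (cartesianProductWith⁺ _∷_ ∷-injective xs-unique (allLists-unique xs-unique n))

∈-allLists⁺ : ∀ {xs w : List A} → All (_∈ xs) w → w ∈ allLists xs (length w)
∈-allLists⁺ []                         = here refl
∈-allLists⁺ {xs = xs} {x ∷ w} (x∈ ∷ w∈) =
  subst (x ∷ w ∈_) (sym (allLists-suc xs (length w)))
        (∈-cartesianProductWith⁺ _∷_ x∈ (∈-allLists⁺ w∈))

∈-allLists⁻ : ∀ {xs w : List A} n → w ∈ allLists xs n → length w ≡ n
∈-allLists⁻ zero (here refl) = refl
∈-allLists⁻ {xs = xs} {w} (suc n) w∈
  with _ , _ , _ , w'∈ , refl ←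
         ∈-cartesianProductWith⁻ _∷_ xs (allLists xs n) (subst (w ∈_) (allLists-suc xs n) w∈)
  = cong suc (∈-allLists⁻ n w'∈)

words-unique : ∀ k n → Unique (words k n)
words-unique k = allLists-unique (allFin⁺ k)

∈-words : ∀ {k} (M : List (Fin k)) → M ∈ words k (length M)
∈-words M = ∈-allLists⁺ (All.universal ∈-allFin M)

occurrences : ℕ → List ℕ → ℕ
occurrences j = length ∘ filter (_≟ j)

IsPerm : List ℕ → Set
IsPerm ρ = ∀ {j} → j < length ρ → occurrences j ρ ≡ 1

countᵇ≡occurrences : ∀ j ρ → countᵇ (_≡ᵇ j) ρ ≡ occurrences j ρ
countᵇ≡occurrences j []      = refl
countᵇ≡occurrences j (x ∷ ρ) with x ≡ᵇ j
... | true  = cong suc (countᵇ≡occurrences j ρ)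
... | false = countᵇ≡occurrences j ρ

T-allᵇ : ∀ (p : A → Bool) xs → T (allᵇ p xs) ⇔ All (T ∘ p) xs
T-allᵇ p []       = mk⇔ (λ _ → []) (λ _ → _)
T-allᵇ p (x ∷ xs) = mk⇔
  (λ t → let px , pxs = to T-∧ t in px ∷ to (T-allᵇ p xs) pxs)
  (λ { (px ∷ pxs) → from T-∧ (px , from (T-allᵇ p xs) pxs) })

T-isPermᵇ : ∀ ρ → T (isPermᵇ ρ) ⇔ IsPerm ρ
T-isPermᵇ ρ = mk⇔
  (λ t {j} j< → trans (sym (countᵇ≡occurrences j ρ))
                       (ℕ.≡ᵇ⇒≡ _ 1 (applyUpTo⁻ id (length ρ) (to (T-allᵇ _ _) t) j<)))
  (λ ρ-perm → from (T-allᵇ _ _) (applyUpTo⁺₁ id (length ρ) λ {j} j< →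
                 ℕ.≡⇒≡ᵇ _ 1 (trans (countᵇ≡occurrences j ρ) (ρ-perm j<))))

occurrences-++ : ∀ j xs ys → occurrences j (xs ++ ys) ≡ occurrences j xs + occurrences j ys
occurrences-++ j xs ys =
  trans (cong length (filter-++ (_≟ j) xs ys)) (length-++ (filter (_≟ j) xs))

occurrences-none : ∀ {j xs} → All (_≢ j) xs → occurrences j xs ≡ 0
occurrences-none {j} xs≢j = cong length (filter-none (_≟ j) xs≢j)

occurrences-∈ : ∀ {j xs} → j ∈ xs → 0 < occurrences j xs
occurrences-∈ {j} j∈ = filter-some (_≟ j) (Any.map sym j∈)

occurrences-shift : ∀ m d τ → occurrences (d + m) (map (_+ m) τ) ≡ occurrences d τ
occurrences-shift m d []      = refl
occurrences-shift m d (x ∷ τ) with x ≟ d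
... | yes refl = begin
  occurrences (x + m) (x + m ∷ map (_+ m) τ) ≡⟨ cong length (filter-accept (_≟ x + m) refl) ⟩
  suc (occurrences (x + m) (map (_+ m) τ))   ≡⟨ cong suc (occurrences-shift m x τ) ⟩
  suc (occurrences x τ)                      ≡⟨ cong length (filter-accept (_≟ x) refl) ⟨
  occurrences x (x ∷ τ)                      ∎
... | no x≢d = begin
  occurrences (d + m) (x + m ∷ map (_+ m) τ)
    ≡⟨ cong length (filter-reject (_≟ d + m) (x≢d ∘ ℕ.+-cancelʳ-≡ m x d)) ⟩
  occurrences (d + m) (map (_+ m) τ) ≡⟨ occurrences-shift m d τ ⟩
  occurrences d τ                    ≡⟨ cong length (filter-reject (_≟ d) x≢d) ⟨
  occurrences d (x ∷ τ)              ∎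

length-filter-<-suc : ∀ m ρ →
  length (filter (_<? suc m) ρ) ≡ length (filter (_<? m) ρ) + occurrences m ρ
length-filter-<-suc m []      = refl
length-filter-<-suc m (x ∷ ρ) with ℕ.<-cmp x m
... | tri< x<m x≢m _ = begin
  length (filter (_<? suc m) (x ∷ ρ))
    ≡⟨ cong length (filter-accept (_<? suc m) (ℕ.m<n⇒m<1+n x<m)) ⟩
  suc (length (filter (_<? suc m) ρ))
    ≡⟨ cong suc (length-filter-<-suc m ρ) ⟩
  suc (length (filter (_<? m) ρ) + occurrences m ρ)
    ≡⟨ cong₂ _+_ (cong length (filter-accept (_<? m) x<m))
                 (cong length (filter-reject (_≟ m) x≢m)) ⟨
  length (filter (_<? m) (x ∷ ρ)) + occurrences m (x ∷ ρ) ∎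
... | tri≈ _ refl _ = begin
  length (filter (_<? suc x) (x ∷ ρ))
    ≡⟨ cong length (filter-accept (_<? suc x) (ℕ.n<1+n x)) ⟩
  suc (length (filter (_<? suc x) ρ))
    ≡⟨ cong suc (length-filter-<-suc x ρ) ⟩
  suc (length (filter (_<? x) ρ) + occurrences x ρ)
    ≡⟨ ℕ.+-suc _ _ ⟨
  length (filter (_<? x) ρ) + suc (occurrences x ρ)
    ≡⟨ cong₂ _+_ (cong length (filter-reject (_<? x) (ℕ.n≮n x)))
                 (cong length (filter-accept (_≟ x) refl)) ⟨
  length (filter (_<? x) (x ∷ ρ)) + occurrences x (x ∷ ρ) ∎
... | tri> _ x≢m m<x = begin
  length (filter (_<? suc m) (x ∷ ρ))
    ≡⟨ cong length (filter-reject (_<? suc m) (ℕ.<⇒≱ m<x ∘ s≤s⁻¹)) ⟩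
  length (filter (_<? suc m) ρ)
    ≡⟨ length-filter-<-suc m ρ ⟩
  length (filter (_<? m) ρ) + occurrences m ρ
    ≡⟨ cong₂ _+_ (cong length (filter-reject (_<? m) (ℕ.<⇒≯ m<x)))
                 (cong length (filter-reject (_≟ m) x≢m)) ⟨
  length (filter (_<? m) (x ∷ ρ)) + occurrences m (x ∷ ρ) ∎

IsPerm⇒length-filter-< : ∀ {ρ} → IsPerm ρ → ∀ m → m ≤ length ρ →
                         length (filter (_<? m) ρ) ≡ m
IsPerm⇒length-filter-< {ρ} ρ-perm zero    _  =
  cong length (filter-none (_<? 0) (All.universal (λ _ ()) ρ))
IsPerm⇒length-filter-< {ρ} ρ-perm (suc m) m< = begin
  length (filter (_<? suc m) ρ)               ≡⟨ length-filter-<-suc m ρ ⟩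
  length (filter (_<? m) ρ) + occurrences m ρ ≡⟨ cong₂ _+_ below-m (ρ-perm m<) ⟩
  m + 1                                       ≡⟨ ℕ.+-comm m 1 ⟩
  suc m                                       ∎
  where below-m = IsPerm⇒length-filter-< {ρ} ρ-perm m (ℕ.<⇒≤ m<)

-- Pigeonhole: the values 0, …, n-1 already fill all n = length ρ places of ρ.
IsPerm⇒All< : ∀ {ρ} → IsPerm ρ → All (_< length ρ) ρ
IsPerm⇒All< {ρ} ρ-perm = decidable-stable (All.all? (_<? length ρ) ρ) λ ¬all< →
  ℕ.<⇒≢ (filter-notAll (_<? length ρ) ρ (¬All⇒Any¬ (_<? length ρ) ρ ¬all<))
        (IsPerm⇒length-filter-< {ρ} ρ-perm (length ρ) ℕ.≤-refl)

perms-unique : ∀ n → Unique (perms n)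
perms-unique n = filter⁺ _ (allLists-unique (upTo⁺ n) n)

∈-perms⁺ : ∀ {ρ} → IsPerm ρ → ρ ∈ perms (length ρ)
∈-perms⁺ {ρ} ρ-perm =
  ∈-filter⁺ _ (∈-allLists⁺ (All.map ∈-upTo⁺ (IsPerm⇒All< {ρ} ρ-perm))) (from (T-isPermᵇ ρ) ρ-perm)

∈-perms⁻ : ∀ {n ρ} → ρ ∈ perms n → IsPerm ρ
∈-perms⁻ {n} {ρ} ρ∈ = to (T-isPermᵇ ρ) (proj₂ (∈-filter⁻ _ {xs = allLists (upTo n) n} ρ∈))

_++⁺_ : List ℕ → List ℕ → List ℕ
σ ++⁺ τ = σ ++ map (_+ length σ) τ

length-++⁺ : ∀ σ τ → length (σ ++⁺ τ) ≡ length σ + length τ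
length-++⁺ σ τ = trans (length-++ σ) (cong (_+_ (length σ)) (length-map (_+ length σ) τ))

IsPerm-++⁺ : ∀ {σ τ} → IsPerm σ → IsPerm τ → IsPerm (σ ++⁺ τ)
IsPerm-++⁺ {σ} {τ} σ-perm τ-perm {j} j< with j <? length σ
... | yes j<σ = begin
  occurrences j (σ ++⁺ τ)                               ≡⟨ occurrences-++ j σ _ ⟩
  occurrences j σ + occurrences j (map (_+ length σ) τ) ≡⟨ cong₂ _+_ (σ-perm j<σ) shifted ⟩
  1                                                     ∎
  where
  shifted : occurrences j (map (_+ length σ) τ) ≡ 0
  shifted = occurrences-none (map⁺ (All.universal (λ x x+σ≡j →
    ℕ.<⇒≱ j<σ (subst (length σ ≤_) x+σ≡j (ℕ.m≤n+m (length σ) x))) τ))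
... | no j≮σ = begin
  occurrences j (σ ++⁺ τ)                               ≡⟨ occurrences-++ j σ _ ⟩
  occurrences j σ + occurrences j (map (_+ length σ) τ) ≡⟨ cong₂ _+_ unshifted shifted ⟩
  1                                                     ∎
  where
  d = j ∸ length σ
  d+σ≡j : d + length σ ≡ j
  d+σ≡j = ℕ.m∸n+n≡m (ℕ.≮⇒≥ j≮σ)
  unshifted : occurrences j σ ≡ 0
  unshifted = occurrences-none
    (All.map (λ x<σ x≡j → j≮σ (subst (_< length σ) x≡j x<σ)) (IsPerm⇒All< {σ} σ-perm))
  d<τ : d < length τ
  d<τ = ℕ.+-cancelʳ-< (length σ) d (length τ)
          (subst₂ _<_ (sym d+σ≡j) (trans (length-++⁺ σ τ) (ℕ.+-comm (length σ) (length τ))) j<)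
  shifted : occurrences j (map (_+ length σ) τ) ≡ 1
  shifted = begin
    occurrences j (map (_+ length σ) τ)
      ≡⟨ cong (λ i → occurrences i (map (_+ length σ) τ)) d+σ≡j ⟨
    occurrences (d + length σ) (map (_+ length σ) τ)
      ≡⟨ occurrences-shift (length σ) d τ ⟩
    occurrences d τ
      ≡⟨ τ-perm d<τ ⟩
    1 ∎

IsPerm-++⁻ : ∀ σ {δ} → IsPerm (σ ++ δ) → IsPerm σ → All (length σ ≤_) δ
IsPerm-++⁻ σ {δ} ρ-perm σ-perm = All.tabulate λ {x} x∈δ → ℕ.≮⇒≥ λ x<σ →
  ℕ.<⇒≢ (occurrences-∈ x∈δ) (sym (absent-from-δ x<σ))
  where
  absent-from-δ : ∀ {x} → x < length σ → occurrences x δ ≡ 0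
  absent-from-δ {x} x<σ = ℕ.suc-injective (begin
    1 + occurrences x δ               ≡⟨ cong (_+ occurrences x δ) (σ-perm x<σ) ⟨
    occurrences x σ + occurrences x δ ≡⟨ occurrences-++ x σ δ ⟨
    occurrences x (σ ++ δ)            ≡⟨ ρ-perm (ℕ.<-≤-trans x<σ (length-++-≤ˡ σ)) ⟩
    1                                 ∎)

BasisPair : ℕ → Set
BasisPair k = List (Fin k) × List ℕ × List (Fin k) × List ℕ

-- A copy of the summand that Defs keeps local to Δcoeff.
hit : ∀ {k} → BasisPair k → Maybe (BasisPair k) → ℤ
hit _                  nothing                = + 0
hit (M' , σ , M'' , τ) (just (A , B , C , D)) =
  if does (≡-dec Fin._≟_ A M' ×-dec ≡-dec _≟_ B σ ×-dec ≡-dec Fin._≟_ C M'' ×-dec ≡-dec _≟_ D τ)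
  then + 1 else + 0

hit-just : ∀ {k} (t : BasisPair k) → hit t (just t) ≡ + 1
hit-just (M' , σ , M'' , τ) = cong (if_then + 1 else + 0) (dec-true
  (≡-dec Fin._≟_ M' M' ×-dec ≡-dec _≟_ σ σ ×-dec ≡-dec Fin._≟_ M'' M'' ×-dec ≡-dec _≟_ τ τ)
  (refl , refl , refl , refl))

hit-≢ : ∀ {k} (t : BasisPair k) {m} → m ≢ just t → hit t m ≡ + 0
hit-≢ t                  {nothing}               _  = refl
hit-≢ (M' , σ , M'' , τ) {just (A , B , C , D)} m≢ = cong (if_then + 1 else + 0) (dec-false
  (≡-dec Fin._≟_ A M' ×-dec ≡-dec _≟_ B σ ×-dec ≡-dec Fin._≟_ C M'' ×-dec ≡-dec _≟_ D τ)
  λ { (refl , refl , refl , refl) → m≢ refl })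

split-just⁻ : ∀ {k} i (M : List (Fin k)) ρ {A B C D} → split i M ρ ≡ just (A , B , C , D) →
  take i M ≡ A × take i ρ ≡ B × drop i M ≡ C × map (_∸ i) (drop i ρ) ≡ D
split-just⁻ i M ρ eq with allᵇ (_<ᵇ i) (take i ρ)
split-just⁻ i M ρ refl | true = refl , refl , refl , refl

split-just⁺ : ∀ {k} i (M : List (Fin k)) ρ → All (_< i) (take i ρ) →
  split i M ρ ≡ just (take i M , take i ρ , drop i M , map (_∸ i) (drop i ρ))
split-just⁺ i M ρ all<
  rewrite to T-≡ (from (T-allᵇ (_<ᵇ i) (take i ρ)) (All.map ℕ.<⇒<ᵇ all<)) = refl

split-++⁺ : ∀ {k} (M' M'' : List (Fin k)) σ τ → length M' ≡ length σ → All (_< length σ) σ →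
  split (length σ) (M' ++ M'') (σ ++⁺ τ) ≡ just (M' , σ , M'' , τ)
split-++⁺ M' M'' σ τ M'≡σ σ<σ = begin
  split i (M' ++ M'') (σ ++⁺ τ)
    ≡⟨ split-just⁺ i (M' ++ M'') (σ ++⁺ τ) (subst (All (_< i)) (sym (take-length-++ σ _)) σ<σ) ⟩
  just (take i (M' ++ M'') , take i (σ ++⁺ τ) , drop i (M' ++ M'') ,
        map (_∸ i) (drop i (σ ++⁺ τ)))
    ≡⟨ cong just (cong₂ _,_ take-M (cong₂ _,_ (take-length-++ σ _) (cong₂ _,_ drop-M drop-ρ))) ⟩
  just (M' , σ , M'' , τ) ∎
  where
  i = length σ
  take-M : take i (M' ++ M'') ≡ M'
  take-M = subst (λ i → take i (M' ++ M'') ≡ M') M'≡σ (take-length-++ M' M'')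
  drop-M : drop i (M' ++ M'') ≡ M''
  drop-M = subst (λ i → drop i (M' ++ M'') ≡ M'') M'≡σ (drop-length-++ M' M'')
  drop-ρ : map (_∸ i) (drop i (σ ++⁺ τ)) ≡ τ
  drop-ρ = trans (cong (map (_∸ i)) (drop-length-++ σ _)) (map-∸-map-+ i τ)

split≡just⇒++⁺ : ∀ {k} {M M' M'' : List (Fin k)} {ρ σ τ} → IsPerm ρ → IsPerm σ →
  split (length σ) M ρ ≡ just (M' , σ , M'' , τ) → M ≡ M' ++ M'' × ρ ≡ σ ++⁺ τ
split≡just⇒++⁺ {M = M} {M'} {M''} {ρ} {σ} {τ} ρ-perm σ-perm eq
  with take-M , take-ρ , drop-M , drop-ρ ← split-just⁻ (length σ) M ρ eq
  = trans (sym (take++drop≡id i M)) (cong₂ _++_ take-M drop-M) , ρ≡σ++⁺τ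
  where
  i = length σ
  ρ≡σ++δ : ρ ≡ σ ++ drop i ρ
  ρ≡σ++δ = trans (sym (take++drop≡id i ρ)) (cong (_++ drop i ρ) take-ρ)
  i≤δ : All (i ≤_) (drop i ρ)
  i≤δ = IsPerm-++⁻ σ (subst IsPerm ρ≡σ++δ ρ-perm) σ-perm
  ρ≡σ++⁺τ : ρ ≡ σ ++⁺ τ
  ρ≡σ++⁺τ = begin
    ρ                                       ≡⟨ ρ≡σ++δ ⟩
    σ ++ drop i ρ                           ≡⟨ cong (σ ++_) (map-+-map-∸ i i≤δ) ⟨
    σ ++ map (_+ i) (map (_∸ i) (drop i ρ)) ≡⟨ cong (λ δ → σ ++ map (_+ i) δ) drop-ρ ⟩
    σ ++⁺ τ                                 ∎

-- Recovers the step function of the fold defining Δcoeff by unifying Δcoeff against its first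
-- unfolding, x + foldr F 0 xs; x must be given because _+ℤ_ is not injective.
foldrStep : {F : ℕ → ℤ → ℤ} (x : ℤ) (xs : List ℕ) (v : ℤ) → v ≡ x +ℤ foldr F (+ 0) xs →
            ℕ → ℤ → ℤ
foldrStep {F} _ _ _ _ = F

Δcoeff≡sum : ∀ {k} (M : List (Fin k)) ρ M' σ M'' τ → Δcoeff M ρ M' σ M'' τ ≡
  sumℤ (map (λ i → hit (M' , σ , M'' , τ) (split i M ρ)) (upTo (suc (length M))))
Δcoeff≡sum M ρ M' σ M'' τ = foldr-as-sumℤ step summand step≡ (upTo (suc (length M)))
  where
  summand : ℕ → ℤ
  summand i = hit (M' , σ , M'' , τ) (split i M ρ)
  step : ℕ → ℤ → ℤ
  step = foldrStep (summand 0) (applyUpTo suc (length M)) (Δcoeff M ρ M' σ M'' τ) refl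
  step≡ : ∀ i a → step i a ≡ summand i +ℤ a
  step≡ i a with split i M ρ
  ... | nothing = refl
  ... | just _  = refl

Δcoeff-single-cut : ∀ {k} (M : List (Fin k)) ρ M' σ M'' τ → length M' ≤ length M →
  Δcoeff M ρ M' σ M'' τ ≡ hit (M' , σ , M'' , τ) (split (length M') M ρ)
Δcoeff-single-cut M ρ M' σ M'' τ M'≤M = trans (Δcoeff≡sum M ρ M' σ M'' τ)
  (sumℤ-map-unique (λ i → hit (M' , σ , M'' , τ) (split i M ρ)) (upTo⁺ _) (∈-upTo⁺ (s≤s M'≤M))
                   other-cut)
  where
  other-cut : ∀ {i} → i ∈ upTo (suc (length M)) → i ≢ length M' →
              hit (M' , σ , M'' , τ) (split i M ρ) ≡ + 0
  other-cut {i} i∈ i≢M' = hit-≢ _ λ eq → i≢M' (begin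
    i                 ≡⟨ ℕ.m≤n⇒m⊓n≡m (s≤s⁻¹ (∈-upTo⁻ i∈)) ⟨
    i ⊓ length M      ≡⟨ length-take i M ⟨
    length (take i M) ≡⟨ cong length (proj₁ (split-just⁻ i M ρ eq)) ⟩
    length M'         ∎)

Δcoeff-++⁺ : ∀ {k} (M' : List (Fin k)) σ M'' τ → length M' ≡ length σ → IsPerm σ →
  Δcoeff (M' ++ M'') (σ ++⁺ τ) M' σ M'' τ ≡ + 1
Δcoeff-++⁺ M' σ M'' τ M'≡σ σ-perm = begin
  Δcoeff (M' ++ M'') (σ ++⁺ τ) M' σ M'' τ
    ≡⟨ Δcoeff-single-cut (M' ++ M'') (σ ++⁺ τ) M' σ M'' τ (length-++-≤ˡ M') ⟩
  hit t (split (length M') (M' ++ M'') (σ ++⁺ τ))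
    ≡⟨ cong (λ i → hit t (split i (M' ++ M'') (σ ++⁺ τ))) M'≡σ ⟩
  hit t (split (length σ) (M' ++ M'') (σ ++⁺ τ))
    ≡⟨ cong (hit t) (split-++⁺ M' M'' σ τ M'≡σ (IsPerm⇒All< {σ} σ-perm)) ⟩
  hit t (just t)
    ≡⟨ hit-just t ⟩
  + 1 ∎
  where t = M' , σ , M'' , τ

Δcoeff-≢++⁺ : ∀ {k} (M : List (Fin k)) ρ M' σ M'' τ → length M' ≡ length σ → IsPerm σ →
  IsPerm ρ → length M' ≤ length M → (M , ρ) ≢ (M' ++ M'' , σ ++⁺ τ) →
  Δcoeff M ρ M' σ M'' τ ≡ + 0
Δcoeff-≢++⁺ M ρ M' σ M'' τ M'≡σ σ-perm ρ-perm M'≤M ≢++⁺ =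
  trans (Δcoeff-single-cut M ρ M' σ M'' τ M'≤M) (hit-≢ (M' , σ , M'' , τ) λ eq →
    let M≡ , ρ≡ = split≡just⇒++⁺ {ρ = ρ} ρ-perm σ-perm (subst (λ i → split i M ρ ≡ _) M'≡σ eq)
    in ≢++⁺ (cong₂ _,_ M≡ ρ≡))

Δ≡sum : ∀ {k} (f : RA k) M' σ M'' τ → let n = length M' + length M'' in
  Δ f M' σ M'' τ ≡ sumℤ (map (uncurry λ M ρ → f M ρ *ℤ Δcoeff M ρ M' σ M'' τ)
                             (cartesianProduct (words k n) (perms n)))
Δ≡sum {k} f M' σ M'' τ = cong sumℤ (trans
  (concatMap-map≡cartesianProductWith g (words k n) (perms n))
  (cartesianProductWith≡map-cartesianProduct g (words k n) (perms n)))
  where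
  n = length M' + length M''
  g : List (Fin k) → List ℕ → ℤ
  g M ρ = f M ρ *ℤ Δcoeff M ρ M' σ M'' τ

Δ≡concat : ∀ {k} (f : RA k) M' σ M'' τ → IsBasis M' σ → IsBasis M'' τ →
  Δ f M' σ M'' τ ≡ f (M' ++ M'') (σ ++⁺ τ)
Δ≡concat {k} f M' σ M'' τ (M'≡σ , σ-permᵇ) (M''≡τ , τ-permᵇ) = begin
  Δ f M' σ M'' τ
    ≡⟨ Δ≡sum f M' σ M'' τ ⟩
  sumℤ (map (uncurry g) (cartesianProduct (words k n) (perms n)))
    ≡⟨ sumℤ-map-unique (uncurry g) (cartesianProduct⁺ (words-unique k n) (perms-unique n))
                       (∈-cartesianProduct⁺ M∈ ρ∈) other-basis ⟩
  f (M' ++ M'') (σ ++⁺ τ) *ℤ Δcoeff (M' ++ M'') (σ ++⁺ τ) M' σ M'' τ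
    ≡⟨ cong (f (M' ++ M'') (σ ++⁺ τ) *ℤ_) (Δcoeff-++⁺ M' σ M'' τ M'≡σ σ-perm) ⟩
  f (M' ++ M'') (σ ++⁺ τ) *ℤ + 1
    ≡⟨ ℤ.*-identityʳ _ ⟩
  f (M' ++ M'') (σ ++⁺ τ) ∎
  where
  n = length M' + length M''
  g : List (Fin k) → List ℕ → ℤ
  g M ρ = f M ρ *ℤ Δcoeff M ρ M' σ M'' τ
  σ-perm : IsPerm σ
  σ-perm = to (T-isPermᵇ σ) σ-permᵇ
  M∈ : M' ++ M'' ∈ words k n
  M∈ = subst (λ n → M' ++ M'' ∈ words k n) (length-++ M') (∈-words (M' ++ M''))
  ρ∈ : σ ++⁺ τ ∈ perms n
  ρ∈ = subst (λ n → σ ++⁺ τ ∈ perms n) (trans (length-++⁺ σ τ) (sym (cong₂ _+_ M'≡σ M''≡τ)))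
             (∈-perms⁺ {σ ++⁺ τ} (IsPerm-++⁺ {σ} {τ} σ-perm (to (T-isPermᵇ τ) τ-permᵇ)))
  other-basis : ∀ {Mρ} → Mρ ∈ cartesianProduct (words k n) (perms n) →
                Mρ ≢ (M' ++ M'' , σ ++⁺ τ) → uncurry g Mρ ≡ + 0
  other-basis {M , ρ} Mρ∈ ≢++⁺
    with M∈ , ρ∈ ← ∈-cartesianProduct⁻ (words k n) (perms n) Mρ∈
    = trans (cong (f M ρ *ℤ_) Δcoeff≡0) (ℤ.*-zeroʳ (f M ρ))
    where
    M'≤M : length M' ≤ length M
    M'≤M = subst (length M' ≤_) (sym (∈-allLists⁻ n M∈)) (ℕ.m≤m+n (length M') (length M''))
    Δcoeff≡0 : Δcoeff M ρ M' σ M'' τ ≡ + 0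
    Δcoeff≡0 = Δcoeff-≢++⁺ M ρ M' σ M'' τ M'≡σ σ-perm (∈-perms⁻ {n} ρ∈) M'≤M ≢++⁺

corollary1p10 : (k : ℕ) (M' M'' : List (Fin k)) (σ τ : List ℕ)
    → IsBasis M' σ → IsBasis M'' τ
    → Δ (J k) M' σ M'' τ ≡ (J k ⊗ J k) M' σ M'' τ
corollary1p10 k M' M'' σ τ = Δ≡concat (J k) M' σ M'' τ
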